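{- Let $\lambda$ be a partition with $|\lambda| = k$. Then for all $n \in \mathbb{N}$ (including $n=0$), \[ \frac{1}{\# \mathcal{OT}(\lambda,k+2n)} \sum_{T \in \mathcal{OT}(\lambda,k+2n)} \mathrm{wt}(T) = \frac{1}{6}\left(4n^2 + 3k^2 + 8 kn + 2n +3k\right).\]
   Context: Young's lattice is the poset of all integer partitions ordered by inclusion of Young diagrams; write $\mu \lessdot \lambda$ if $\lambda$ is obtained from $\mu$ by adding one box. $|\lambda|$ denotes the size (number of boxes) of $\lambda$. An oscillating tableau of shape $\lambda$ and length $l$ is a sequence of partitions $T=(\lambda^{0},\lambda^{1},\ldots,\lambda^{l})$ with $\lambda^0=\emptyset$, $\lambda^l=\lambda$, and for each $1\le i\le l$ either $\lambda^{i-1}\lessdot\lambda^{i}$ or $\lambda^{i}\lessdot\lambda^{i-1}$. $\mathcal{OT}(\lambda,l)$ denotes the set of such tableaux. The weight of $T=(\lambda^{0},\ldots,\lambda^{l})$ is $\mathrm{wt}(T) := \sum_{i=0}^{l} |\lambda^{i}|$. -}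

module Defs where

open import Data.Nat using (ℕ; zero; suc; _≥_; _<_)
open import Data.List using (List; []; _∷_; map; length; head; last)
open import Data.Nat.ListAction using (sum)
open import Data.List.Relation.Unary.All using (All)
open import Data.List.Relation.Unary.Linked using (Linked)
open import Data.Maybe using (just)
open import Data.Product using (_×_)
open import Data.Sum using (_⊎_)
open import Relation.Binary.PropositionalEquality using (_≡_)

IsPartition : List ℕ → Set
IsPartition xs = Linked _≥_ xs × All (0 <_) xs

size : List ℕ → ℕ
size = sum

data AddOne : List ℕ → List ℕ → Set where
  new   : AddOne [] (1 ∷ [])
  here  : ∀ {a xs} → AddOne (a ∷ xs) (suc a ∷ xs)
  there : ∀ {a xs ys} → AddOne xs ys → AddOne (a ∷ xs) (a ∷ ys)

_⋖_ : List ℕ → List ℕ → Set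
μ ⋖ ν = IsPartition μ × IsPartition ν × AddOne μ ν

Adjacent : List ℕ → List ℕ → Set
Adjacent μ ν = (μ ⋖ ν) ⊎ (ν ⋖ μ)

IsOT : List ℕ → ℕ → List (List ℕ) → Set
IsOT shape l T =
  (length T ≡ suc l) × (head T ≡ just []) × (last T ≡ just shape) × Linked Adjacent T

wt : List (List ℕ) → ℕ
wt T = sum (map size T)

-- Write f_l(ρ) = #𝒪𝒯(ρ,l) and g_l(ρ) for the total weight of 𝒪𝒯(ρ,l), and for a function h on
-- partitions let (U h)(ρ) and (D h)(ρ) sum h over the partitions covering ρ, resp. covered by ρ.
-- Removing the last shape of a tableau gives f_{l+1} = U f_l + D f_l and
-- g_{l+1}(ρ) = (U g_l + D g_l)(ρ) + |ρ| f_{l+1}(ρ).  Young's lattice is 1-differential,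
-- U ∘ D = id + D ∘ U, and from this induction on l gives U f_l = l f_{l-1} and
-- |ρ| f_l(ρ) = l (D f_{l-1})(ρ).  With these two identities, induction on l proves
-- 6 g_l(ρ) = (l+1)(l+2|ρ|) f_l(ρ) for every partition ρ and every l; for l = |ρ| + 2n this is the
-- claimed formula.
module Submission where

open import Defs
open import Data.Bool using (Bool; true; false; T; _∧_; if_then_else_)
open import Data.Bool.Properties using (∧-comm; ∧-identityʳ)
open import Data.Empty using (⊥-elim)
open import Data.List
  using (List; []; _∷_; _++_; _∷ʳ_; length; map; head; last; concatMap; filterᵇ; downFrom; initLast; _∷ʳ′_)
open import Data.List.Properties using (length-++; length-map; map-∘; ∷ʳ-injectiveˡ)
open import Data.List.Membership.Propositional using (_∈_; find; lose)
open import Data.List.Membership.Propositional.Properties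
  using (∈-map⁺; ∈-map⁻; ∈-++⁺ˡ; ∈-++⁺ʳ; ∈-++⁻; ∈-concatMap⁺; ∈-concatMap⁻; ∈-filter⁺; ∈-filter⁻; ∈-downFrom⁺; ∈-downFrom⁻)
open import Data.List.Membership.Propositional.Properties.WithK using (unique∧set⇒bag)
open import Data.List.Relation.Binary.BagAndSetEquality using (∼bag⇒↭)
open import Data.List.Relation.Binary.Disjoint.Propositional using (Disjoint)
open import Data.List.Relation.Binary.Permutation.Propositional using (_↭_)
open import Data.List.Relation.Binary.Permutation.Propositional.Properties using (↭-length) renaming (map⁺ to ↭-map⁺)
open import Data.List.Relation.Unary.All as All using (All; []; _∷_)
import Data.List.Relation.Unary.All.Properties as All
open import Data.List.Relation.Unary.AllPairs as AllPairs using ([]; _∷_)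
import Data.List.Relation.Unary.AllPairs.Properties as AllPairs
open import Data.List.Relation.Unary.Any using (here; there)
open import Data.List.Relation.Unary.Linked using (Linked; []; [-]; _∷_)
open import Data.List.Relation.Unary.Unique.Propositional using (Unique)
import Data.List.Relation.Unary.Unique.Propositional.Properties as Unique
open import Data.Maybe using (just)
open import Data.Maybe.Properties using (just-injective)
open import Data.Nat using (ℕ; zero; suc; pred; _+_; _*_; _≤_; _<_; _≥_; _<ᵇ_; _≟_; z≤n; s≤s; z<s)
open import Data.Nat.ListAction using (sum)
open import Data.Nat.ListAction.Properties using (sum-↭)
open import Data.Nat.Properties
open import Data.Nat.Tactic.RingSolver using (solve-∀)
open import Data.Product using (∃-syntax; _×_; _,_; proj₂)
open import Data.Sum using (inj₁; inj₂)
open import Function using (_∘_)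
open import Function.Bundles using (_⇔_; mk⇔; Equivalence)
open import Relation.Nullary using (yes; no)
open import Relation.Nullary.Decidable using (T?)
open import Relation.Binary.PropositionalEquality

module _ {A : Set} where

  last-∷ʳ : ∀ (xs : List A) y → last (xs ∷ʳ y) ≡ just y
  last-∷ʳ [] y = refl
  last-∷ʳ (x ∷ []) y = refl
  last-∷ʳ (x ∷ x′ ∷ xs) y = last-∷ʳ (x′ ∷ xs) y

  length-∷ʳ : ∀ (xs : List A) y → length (xs ∷ʳ y) ≡ suc (length xs)
  length-∷ʳ [] y = refl
  length-∷ʳ (x ∷ xs) y = cong suc (length-∷ʳ xs y)

  length-∷ʳ⁻ : ∀ (xs : List A) {y n} → length (xs ∷ʳ y) ≡ suc n → length xs ≡ n
  length-∷ʳ⁻ xs {y} eq = suc-injective (trans (sym (length-∷ʳ xs y)) eq)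

  head-∷ʳ : ∀ {xs : List A} {n} y → length xs ≡ suc n → head (xs ∷ʳ y) ≡ head xs
  head-∷ʳ {_ ∷ _} y _ = refl

  last-∃ : ∀ (xs : List A) {n} → length xs ≡ suc n → ∃[ z ] last xs ≡ just z
  last-∃ (x ∷ []) _ = x , refl
  last-∃ (x ∷ x′ ∷ xs) {suc n} eq = last-∃ (x′ ∷ xs) (suc-injective eq)

  Linked-∷ʳ⁺ : ∀ {R : A → A → Set} {xs y} → Linked R xs → (∀ {z} → last xs ≡ just z → R z y) →
    Linked R (xs ∷ʳ y)
  Linked-∷ʳ⁺ [] _ = [-]
  Linked-∷ʳ⁺ {xs = x ∷ []} [-] r = r refl ∷ [-]
  Linked-∷ʳ⁺ {xs = x ∷ x′ ∷ xs} (r ∷ l) r′ = r ∷ Linked-∷ʳ⁺ l r′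

  Linked-∷ʳ⁻ : ∀ {R : A → A → Set} xs {y} → Linked R (xs ∷ʳ y) →
    Linked R xs × (∀ {z} → last xs ≡ just z → R z y)
  Linked-∷ʳ⁻ [] _ = [] , λ ()
  Linked-∷ʳ⁻ (x ∷ []) (r ∷ _) = [-] , λ { refl → r }
  Linked-∷ʳ⁻ (x ∷ x′ ∷ xs) (r ∷ l) with Linked-∷ʳ⁻ (x′ ∷ xs) l
  ... | l′ , r′ = r ∷ l′ , r′

module _ {A B : Set} where

  unique-map-local : ∀ {f : A → B} {xs} → Unique xs →
    (∀ {x y} → x ∈ xs → y ∈ xs → f x ≡ f y → x ≡ y) → Unique (map f xs)
  unique-map-local [] _ = []
  unique-map-local (x∉xs ∷ u) inj =
    All.map⁺ (All.tabulate λ y∈xs fx≡fy → All.lookup x∉xs y∈xs (inj (here refl) (there y∈xs) fx≡fy))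
    ∷ unique-map-local u (λ x∈ y∈ → inj (there x∈) (there y∈))

  unique-concatMap : ∀ {g : A → List B} {xs} → Unique xs → (∀ {x} → x ∈ xs → Unique (g x)) →
    (∀ {x y} → x ≢ y → Disjoint (g x) (g y)) → Unique (concatMap g xs)
  unique-concatMap u ug disjoint =
    Unique.concat⁺ (All.map⁺ (All.tabulate ug)) (AllPairs.map⁺ (AllPairs.map disjoint u))

module _ {A : Set} where

  sum-map-cong : ∀ {f g : A → ℕ} xs → (∀ {x} → x ∈ xs → f x ≡ g x) → sum (map f xs) ≡ sum (map g xs)
  sum-map-cong [] _ = refl
  sum-map-cong (x ∷ xs) f≡g = cong₂ _+_ (f≡g (here refl)) (sum-map-cong xs (f≡g ∘ there))

  sum-map-0 : ∀ (xs : List A) → sum (map (λ _ → 0) xs) ≡ 0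
  sum-map-0 [] = refl
  sum-map-0 (x ∷ xs) = sum-map-0 xs

  sum-map-+ : ∀ (f g : A → ℕ) xs → sum (map (λ x → f x + g x) xs) ≡ sum (map f xs) + sum (map g xs)
  sum-map-+ f g [] = refl
  sum-map-+ f g (x ∷ xs) = begin
    f x + g x + sum (map (λ x → f x + g x) xs)     ≡⟨ cong (f x + g x +_) (sum-map-+ f g xs) ⟩
    f x + g x + (sum (map f xs) + sum (map g xs)) ≡⟨ +-+-assoc-comm (f x) (g x) _ _ ⟩
    f x + sum (map f xs) + (g x + sum (map g xs)) ∎
    where
    open ≡-Reasoning
    +-+-assoc-comm : ∀ a b c d → a + b + (c + d) ≡ a + c + (b + d)
    +-+-assoc-comm = solve-∀

  sum-map-* : ∀ c (f : A → ℕ) xs → sum (map (λ x → c * f x) xs) ≡ c * sum (map f xs)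
  sum-map-* c f [] = sym (*-zeroʳ c)
  sum-map-* c f (x ∷ xs) = trans (cong (c * f x +_) (sum-map-* c f xs)) (sym (*-distribˡ-+ c (f x) _))

  sum-map-++ : ∀ (f : A → ℕ) xs ys → sum (map f (xs ++ ys)) ≡ sum (map f xs) + sum (map f ys)
  sum-map-++ f [] ys = refl
  sum-map-++ f (x ∷ xs) ys = trans (cong (f x +_) (sum-map-++ f xs ys)) (sym (+-assoc (f x) _ _))

  sum-map-filterᵇ : ∀ p (f : A → ℕ) xs → sum (map f (filterᵇ p xs)) ≡ sum (map (λ x → if p x then f x else 0) xs)
  sum-map-filterᵇ p f [] = refl
  sum-map-filterᵇ p f (x ∷ xs) with p x
  ... | true = cong (f x +_) (sum-map-filterᵇ p f xs)
  ... | false = sum-map-filterᵇ p f xs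

  if-sum-map : ∀ b (f : A → ℕ) xs → (if b then sum (map f xs) else 0) ≡ sum (map (λ x → if b then f x else 0) xs)
  if-sum-map true f xs = refl
  if-sum-map false f xs = sym (sum-map-0 xs)

  sum-map-comm : ∀ (f : A → A → ℕ) xs ys →
    sum (map (λ x → sum (map (f x) ys)) xs) ≡ sum (map (λ y → sum (map (λ x → f x y) xs)) ys)
  sum-map-comm f [] ys = sym (sum-map-0 ys)
  sum-map-comm f (x ∷ xs) ys =
    trans (cong (sum (map (f x) ys) +_) (sum-map-comm f xs ys)) (sym (sum-map-+ (f x) _ ys))

module _ {A B : Set} where

  sum-map-concatMap : ∀ (f : B → ℕ) (g : A → List B) xs →
    sum (map f (concatMap g xs)) ≡ sum (map (λ x → sum (map f (g x))) xs)
  sum-map-concatMap f g [] = refl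
  sum-map-concatMap f g (x ∷ xs) =
    trans (sum-map-++ f (g x) (concatMap g xs)) (cong (sum (map f (g x)) +_) (sum-map-concatMap f g xs))

  length-concatMap : ∀ (g : A → List B) xs → length (concatMap g xs) ≡ sum (map (length ∘ g) xs)
  length-concatMap g [] = refl
  length-concatMap g (x ∷ xs) = trans (length-++ (g x)) (cong (length (g x) +_) (length-concatMap g xs))

if-congᵀ : ∀ b {x y} → (T b → x ≡ y) → (if b then x else 0) ≡ (if b then y else 0)
if-congᵀ true x≡y = x≡y _
if-congᵀ false _ = refl

if-T : ∀ {b} {x y : ℕ} → T b → (if b then x else y) ≡ x
if-T {true} _ = refl

if-∧ : ∀ a b (x : ℕ) → (if a then (if b then x else 0) else 0) ≡ (if a ∧ b then x else 0)
if-∧ true b x = refl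
if-∧ false b x = refl

∑< : ℕ → (ℕ → ℕ) → ℕ
∑< N f = sum (map f (downFrom N))

∑<-cong : ∀ N {f g} → (∀ {i} → i < N → f i ≡ g i) → ∑< N f ≡ ∑< N g
∑<-cong N f≡g = sum-map-cong (downFrom N) (f≡g ∘ ∈-downFrom⁻)

∑<-pad : ∀ {M} N f → M ≤ N → (∀ {i} → M ≤ i → f i ≡ 0) → ∑< N f ≡ ∑< M f
∑<-pad {M} zero f z≤n _ = refl
∑<-pad {M} (suc N) f M≤1+N f≡0 with M ≟ suc N
... | yes refl = refl
... | no M≢1+N = trans (cong (_+ ∑< N f) (f≡0 M≤N)) (∑<-pad N f M≤N f≡0)
  where M≤N = ≤-pred (≤∧≢⇒< M≤1+N M≢1+N)

∑<-suc : ∀ N f → ∑< (suc N) f ≡ f 0 + ∑< N (f ∘ suc)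
∑<-suc zero f = refl
∑<-suc (suc N) f = begin
  f (suc N) + ∑< (suc N) f               ≡⟨ cong (f (suc N) +_) (∑<-suc N f) ⟩
  f (suc N) + (f 0 + ∑< N (f ∘ suc))     ≡⟨ +-swapˡ (f (suc N)) (f 0) _ ⟩
  f 0 + (f (suc N) + ∑< N (f ∘ suc))     ∎
  where
  open ≡-Reasoning
  +-swapˡ : ∀ a b c → a + (b + c) ≡ b + (a + c)
  +-swapˡ = solve-∀

∑<-exchange : ∀ N {f g} i → i < N → (∀ {j} → j ≢ i → f j ≡ g j) → ∑< N f + g i ≡ ∑< N g + f i
∑<-exchange (suc N) {f} {g} i i<1+N f≡g with i ≟ N
... | yes refl = begin
  f i + ∑< i f + g i ≡⟨ cong (λ s → f i + s + g i) (∑<-cong i (f≡g ∘ <⇒≢)) ⟩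
  f i + ∑< i g + g i ≡⟨ swap (f i) (∑< i g) (g i) ⟩
  g i + ∑< i g + f i ∎
  where
  open ≡-Reasoning
  swap : ∀ a b c → a + b + c ≡ c + b + a
  swap = solve-∀
... | no i≢N = begin
  f N + ∑< N f + g i   ≡⟨ +-assoc (f N) _ _ ⟩
  f N + (∑< N f + g i) ≡⟨ cong₂ _+_ (f≡g (i≢N ∘ sym)) (∑<-exchange N i (≤∧≢⇒< (≤-pred i<1+N) i≢N) f≡g) ⟩
  g N + (∑< N g + f i) ≡⟨ +-assoc (g N) _ _ ⟨
  g N + ∑< N g + f i   ∎
  where open ≡-Reasoning

∑<-∑<-exchange : ∀ N (F G : ℕ → ℕ → ℕ) → (∀ {i j} → i ≢ j → F i j ≡ G i j) →
  ∑< N (λ i → ∑< N (F i)) + ∑< N (λ i → G i i) ≡ ∑< N (λ i → ∑< N (G i)) + ∑< N (λ i → F i i)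
∑<-∑<-exchange N F G F≡G = begin
  ∑< N (λ i → ∑< N (F i)) + ∑< N (λ i → G i i) ≡⟨ sum-map-+ _ _ (downFrom N) ⟨
  ∑< N (λ i → ∑< N (F i) + G i i)              ≡⟨ ∑<-cong N (λ {i} i<N → ∑<-exchange N i i<N (λ j≢i → F≡G (j≢i ∘ sym))) ⟩
  ∑< N (λ i → ∑< N (G i) + F i i)              ≡⟨ sum-map-+ _ _ (downFrom N) ⟩
  ∑< N (λ i → ∑< N (G i)) + ∑< N (λ i → F i i) ∎
  where open ≡-Reasoning

infixl 9 _!_
infixr 5 _∷₊_

_!_ : List ℕ → ℕ → ℕ
[] ! _ = 0
(x ∷ xs) ! zero = x
(x ∷ xs) ! suc m = xs ! m

-- Only meaningful for addable rows: beyond the bottom row addAt pads with empty rows.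
addAt : ℕ → List ℕ → List ℕ
addAt zero [] = 1 ∷ []
addAt zero (x ∷ xs) = suc x ∷ xs
addAt (suc i) [] = 0 ∷ addAt i []
addAt (suc i) (x ∷ xs) = x ∷ addAt i xs

-- Used by remAt, so that removing the last box of the bottom row deletes that row.
_∷₊_ : ℕ → List ℕ → List ℕ
zero ∷₊ [] = []
zero ∷₊ (y ∷ ys) = 0 ∷ y ∷ ys
suc x ∷₊ xs = suc x ∷ xs

remAt : ℕ → List ℕ → List ℕ
remAt _ [] = []
remAt zero (x ∷ xs) = pred x ∷₊ xs
remAt (suc j) (x ∷ xs) = x ∷ remAt j xs

∷₊-! : ∀ x xs m → (x ∷₊ xs) ! m ≡ (x ∷ xs) ! m
∷₊-! zero [] zero = refl
∷₊-! zero [] (suc m) = refl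
∷₊-! zero (y ∷ ys) m = refl
∷₊-! (suc x) xs m = refl

addAt-!-same : ∀ i xs → addAt i xs ! i ≡ suc (xs ! i)
addAt-!-same zero [] = refl
addAt-!-same zero (x ∷ xs) = refl
addAt-!-same (suc i) [] = addAt-!-same i []
addAt-!-same (suc i) (x ∷ xs) = addAt-!-same i xs

addAt-!-other : ∀ {i m} xs → i ≢ m → addAt i xs ! m ≡ xs ! m
addAt-!-other {zero} {zero} xs i≢m = ⊥-elim (i≢m refl)
addAt-!-other {zero} {suc m} [] _ = refl
addAt-!-other {zero} {suc m} (x ∷ xs) _ = refl
addAt-!-other {suc i} {zero} [] _ = refl
addAt-!-other {suc i} {zero} (x ∷ xs) _ = refl
addAt-!-other {suc i} {suc m} [] i≢m = addAt-!-other [] (i≢m ∘ cong suc)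
addAt-!-other {suc i} {suc m} (x ∷ xs) i≢m = addAt-!-other xs (i≢m ∘ cong suc)

remAt-!-same : ∀ j xs → remAt j xs ! j ≡ pred (xs ! j)
remAt-!-same j [] = refl
remAt-!-same zero (x ∷ xs) = ∷₊-! (pred x) xs 0
remAt-!-same (suc j) (x ∷ xs) = remAt-!-same j xs

remAt-!-other : ∀ {j m} xs → j ≢ m → remAt j xs ! m ≡ xs ! m
remAt-!-other [] _ = refl
remAt-!-other {zero} {zero} (x ∷ xs) j≢m = ⊥-elim (j≢m refl)
remAt-!-other {zero} {suc m} (x ∷ xs) _ = ∷₊-! (pred x) xs (suc m)
remAt-!-other {suc j} {zero} (x ∷ xs) _ = refl
remAt-!-other {suc j} {suc m} (x ∷ xs) j≢m = remAt-!-other xs (j≢m ∘ cong suc)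

!-≤-addAt : ∀ i xs m → xs ! m ≤ addAt i xs ! m
!-≤-addAt i xs m with i ≟ m
... | yes refl = ≤-trans (n≤1+n (xs ! i)) (≤-reflexive (sym (addAt-!-same i xs)))
... | no i≢m = ≤-reflexive (sym (addAt-!-other xs i≢m))

remAt-!-≤ : ∀ j xs m → remAt j xs ! m ≤ xs ! m
remAt-!-≤ j xs m with j ≟ m
... | yes refl = ≤-trans (≤-reflexive (remAt-!-same j xs)) pred[n]≤n
... | no j≢m = ≤-reflexive (remAt-!-other xs j≢m)

!-pos⇒<length : ∀ xs m → 0 < xs ! m → m < length xs
!-pos⇒<length (x ∷ xs) zero _ = z<s
!-pos⇒<length (x ∷ xs) (suc m) p = s≤s (!-pos⇒<length xs m p)

pred[n]<n : ∀ {n} → 0 < n → pred n < n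
pred[n]<n {suc n} _ = n<1+n n

Decreasing : List ℕ → Set
Decreasing xs = ∀ m → xs ! suc m ≤ xs ! m

linked⇒decreasing : ∀ {xs} → Linked _≥_ xs → Decreasing xs
linked⇒decreasing [] m = z≤n
linked⇒decreasing [-] zero = z≤n
linked⇒decreasing [-] (suc m) = z≤n
linked⇒decreasing (x≥y ∷ _) zero = x≥y
linked⇒decreasing (_ ∷ l) (suc m) = linked⇒decreasing l m

decreasing⇒linked : ∀ xs → Decreasing xs → Linked _≥_ xs
decreasing⇒linked [] _ = []
decreasing⇒linked (x ∷ []) _ = [-]
decreasing⇒linked (x ∷ y ∷ xs) d = d 0 ∷ decreasing⇒linked (y ∷ xs) (d ∘ suc)

partition⇒decreasing : ∀ {xs} → IsPartition xs → Decreasing xs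
partition⇒decreasing (l , _) = linked⇒decreasing l

-- A box fits at the end of row i+1 exactly when one can be taken from the end of row i.
removable addable : List ℕ → ℕ → Bool
removable xs j = xs ! suc j <ᵇ xs ! j
addable xs zero = true
addable xs (suc i) = removable xs i

removable⇒< : ∀ xs j → T (removable xs j) → xs ! suc j < xs ! j
removable⇒< xs j = <ᵇ⇒< (xs ! suc j) (xs ! j)

removable⇒pos : ∀ xs j → T (removable xs j) → 0 < xs ! j
removable⇒pos xs j r = m<n⇒0<n (removable⇒< xs j r)

addable⇒≤length : ∀ xs i → T (addable xs i) → i ≤ length xs
addable⇒≤length xs zero _ = z≤n
addable⇒≤length xs (suc i) a = !-pos⇒<length xs i (removable⇒pos xs i a)

removable-addAt : ∀ i xs → Decreasing xs → T (removable (addAt i xs) i)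
removable-addAt i xs d = <⇒<ᵇ (begin-strict
  addAt i xs ! suc i ≡⟨ addAt-!-other xs (1+n≢n ∘ sym) ⟩
  xs ! suc i         ≤⟨ d i ⟩
  xs ! i             <⟨ n<1+n (xs ! i) ⟩
  suc (xs ! i)       ≡⟨ addAt-!-same i xs ⟨
  addAt i xs ! i     ∎)
  where open ≤-Reasoning

addable-remAt : ∀ j xs → Decreasing xs → T (removable xs j) → T (addable (remAt j xs) j)
addable-remAt zero xs d r = _
addable-remAt (suc j) xs d r = <⇒<ᵇ (begin-strict
  remAt (suc j) xs ! suc j ≡⟨ remAt-!-same (suc j) xs ⟩
  pred (xs ! suc j)        <⟨ pred[n]<n (removable⇒pos xs (suc j) r) ⟩
  xs ! suc j               ≤⟨ d j ⟩
  xs ! j                   ≡⟨ remAt-!-other xs 1+n≢n ⟨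
  remAt (suc j) xs ! j     ∎)
  where open ≤-Reasoning

addAt-decreasing⁻ : ∀ i xs → Decreasing (addAt i xs) → T (addable xs i)
addAt-decreasing⁻ zero xs _ = _
addAt-decreasing⁻ (suc i) xs d = <⇒<ᵇ (begin-strict
  xs ! suc i               <⟨ n<1+n (xs ! suc i) ⟩
  suc (xs ! suc i)         ≡⟨ addAt-!-same (suc i) xs ⟨
  addAt (suc i) xs ! suc i ≤⟨ d i ⟩
  addAt (suc i) xs ! i     ≡⟨ addAt-!-other xs 1+n≢n ⟩
  xs ! i                   ∎)
  where open ≤-Reasoning

addAt-decreasing⁺ : ∀ i xs → Decreasing xs → T (addable xs i) → Decreasing (addAt i xs)
addAt-decreasing⁺ i xs d a m with i ≟ suc m
... | yes refl = begin
  addAt (suc m) xs ! suc m ≡⟨ addAt-!-same (suc m) xs ⟩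
  suc (xs ! suc m)         ≤⟨ removable⇒< xs m a ⟩
  xs ! m                   ≡⟨ addAt-!-other xs 1+n≢n ⟨
  addAt (suc m) xs ! m     ∎
  where open ≤-Reasoning
... | no i≢1+m = begin
  addAt i xs ! suc m ≡⟨ addAt-!-other xs i≢1+m ⟩
  xs ! suc m         ≤⟨ d m ⟩
  xs ! m             ≤⟨ !-≤-addAt i xs m ⟩
  addAt i xs ! m     ∎
  where open ≤-Reasoning

remAt-decreasing : ∀ j xs → Decreasing xs → T (removable xs j) → Decreasing (remAt j xs)
remAt-decreasing j xs d r m with j ≟ m
... | yes refl = begin
  remAt j xs ! suc j ≡⟨ remAt-!-other xs (1+n≢n ∘ sym) ⟩
  xs ! suc j         ≤⟨ <⇒≤pred (removable⇒< xs j r) ⟩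
  pred (xs ! j)      ≡⟨ remAt-!-same j xs ⟨
  remAt j xs ! j     ∎
  where open ≤-Reasoning
... | no j≢m = begin
  remAt j xs ! suc m ≤⟨ remAt-!-≤ j xs (suc m) ⟩
  xs ! suc m         ≤⟨ d m ⟩
  xs ! m             ≡⟨ remAt-!-other xs j≢m ⟨
  remAt j xs ! m     ∎
  where open ≤-Reasoning

addAt-positive : ∀ i xs → All (0 <_) xs → i ≤ length xs → All (0 <_) (addAt i xs)
addAt-positive zero [] _ _ = z<s ∷ []
addAt-positive zero (x ∷ xs) (_ ∷ pxs) _ = z<s ∷ pxs
addAt-positive (suc i) (x ∷ xs) (px ∷ pxs) (s≤s i≤n) = px ∷ addAt-positive i xs pxs i≤n

remAt-positive : ∀ j xs → All (0 <_) xs → T (removable xs j) → All (0 <_) (remAt j xs)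
remAt-positive j [] _ _ = []
remAt-positive zero (suc zero ∷ []) _ _ = []
remAt-positive zero (suc zero ∷ y ∷ ys) (_ ∷ y>0 ∷ _) r = ⊥-elim (<⇒≱ (removable⇒< (1 ∷ y ∷ ys) 0 r) y>0)
remAt-positive zero (suc (suc x) ∷ xs) (_ ∷ pxs) _ = z<s ∷ pxs
remAt-positive (suc j) (x ∷ xs) (px ∷ pxs) r = px ∷ remAt-positive j xs pxs r

addAt-partition : ∀ i {xs} → IsPartition xs → T (addable xs i) → IsPartition (addAt i xs)
addAt-partition i {xs} (l , pos) a =
  decreasing⇒linked _ (addAt-decreasing⁺ i xs (linked⇒decreasing l) a) ,
  addAt-positive i xs pos (addable⇒≤length xs i a)

remAt-partition : ∀ j {xs} → IsPartition xs → T (removable xs j) → IsPartition (remAt j xs)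
remAt-partition j {xs} (l , pos) r =
  decreasing⇒linked _ (remAt-decreasing j xs (linked⇒decreasing l) r) ,
  remAt-positive j xs pos r

remAt-addAt : ∀ i xs → All (0 <_) xs → i ≤ length xs → remAt i (addAt i xs) ≡ xs
remAt-addAt zero [] _ _ = refl
remAt-addAt zero (suc x ∷ xs) _ _ = refl
remAt-addAt zero (zero ∷ xs) (() ∷ _) _
remAt-addAt (suc i) (x ∷ xs) (_ ∷ pxs) (s≤s i≤n) = cong (x ∷_) (remAt-addAt i xs pxs i≤n)

addAt-remAt : ∀ j xs → T (removable xs j) → addAt j (remAt j xs) ≡ xs
addAt-remAt zero (suc zero ∷ []) _ = refl
addAt-remAt zero (suc zero ∷ y ∷ ys) _ = refl
addAt-remAt zero (suc (suc x) ∷ xs) _ = refl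
addAt-remAt (suc j) (x ∷ xs) r = cong (x ∷_) (addAt-remAt j xs r)

∷₊-addAt : ∀ i xs → 0 ∷₊ addAt i xs ≡ 0 ∷ addAt i xs
∷₊-addAt zero [] = refl
∷₊-addAt zero (x ∷ xs) = refl
∷₊-addAt (suc i) [] = refl
∷₊-addAt (suc i) (x ∷ xs) = refl

addAt-∷₊ : ∀ i xs → addAt (suc i) (0 ∷₊ xs) ≡ 0 ∷ addAt i xs
addAt-∷₊ i [] = refl
addAt-∷₊ i (y ∷ ys) = refl

remAt-addAt-comm : ∀ {i j} xs → i ≢ j → remAt j (addAt i xs) ≡ addAt i (remAt j xs)
remAt-addAt-comm {zero} {zero} xs i≢j = ⊥-elim (i≢j refl)
remAt-addAt-comm {zero} {suc j} [] _ = refl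
remAt-addAt-comm {zero} {suc j} (x ∷ xs) _ = refl
remAt-addAt-comm {suc i} {zero} [] _ = ∷₊-addAt i []
remAt-addAt-comm {suc i} {zero} (zero ∷ xs) _ = trans (∷₊-addAt i xs) (sym (addAt-∷₊ i xs))
remAt-addAt-comm {suc i} {zero} (suc zero ∷ xs) _ = trans (∷₊-addAt i xs) (sym (addAt-∷₊ i xs))
remAt-addAt-comm {suc i} {zero} (suc (suc x) ∷ xs) _ = refl
remAt-addAt-comm {suc i} {suc j} [] i≢j = cong (0 ∷_) (remAt-addAt-comm [] (i≢j ∘ cong suc))
remAt-addAt-comm {suc i} {suc j} (x ∷ xs) i≢j = cong (x ∷_) (remAt-addAt-comm xs (i≢j ∘ cong suc))

removable-cong : ∀ xs ys j → xs ! suc j ≡ ys ! suc j → xs ! j ≡ ys ! j → removable xs j ≡ removable ys j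
removable-cong xs ys j = cong₂ _<ᵇ_

suc<ᵇ≡<ᵇpred : ∀ m n → (suc m <ᵇ n) ≡ (m <ᵇ pred n)
suc<ᵇ≡<ᵇpred m zero = refl
suc<ᵇ≡<ᵇpred m (suc n) = refl

addable-removable-comm : ∀ xs {i j} → i ≢ j →
  addable xs i ∧ removable (addAt i xs) j ≡ removable xs j ∧ addable (remAt j xs) i
addable-removable-comm xs {zero} {zero} i≢j = ⊥-elim (i≢j refl)
addable-removable-comm xs {zero} {suc j} _ = begin
  removable (addAt 0 xs) (suc j)
    ≡⟨ removable-cong (addAt 0 xs) xs (suc j) (addAt-!-other {0} xs λ ()) (addAt-!-other {0} xs λ ()) ⟩
  removable xs (suc j)           ≡⟨ ∧-identityʳ _ ⟨
  removable xs (suc j) ∧ true    ∎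
  where open ≡-Reasoning
addable-removable-comm xs {suc i} {j} i≢j with i ≟ j
... | yes refl = cong (removable xs i ∧_) (begin
  addAt (suc i) xs ! suc i <ᵇ addAt (suc i) xs ! i ≡⟨ cong₂ _<ᵇ_ (addAt-!-same (suc i) xs) (addAt-!-other xs 1+n≢n) ⟩
  suc (xs ! suc i) <ᵇ xs ! i                       ≡⟨ suc<ᵇ≡<ᵇpred (xs ! suc i) (xs ! i) ⟩
  xs ! suc i <ᵇ pred (xs ! i)                      ≡⟨ cong₂ _<ᵇ_ (remAt-!-other xs (1+n≢n ∘ sym)) (remAt-!-same i xs) ⟨
  remAt i xs ! suc i <ᵇ remAt i xs ! i             ∎)
  where open ≡-Reasoning
... | no i≢j′ = begin
  removable xs i ∧ removable (addAt (suc i) xs) j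
    ≡⟨ cong (removable xs i ∧_)
            (removable-cong (addAt (suc i) xs) xs j (addAt-!-other xs (i≢j′ ∘ suc-injective)) (addAt-!-other xs i≢j)) ⟩
  removable xs i ∧ removable xs j                 ≡⟨ ∧-comm (removable xs i) (removable xs j) ⟩
  removable xs j ∧ removable xs i
    ≡⟨ cong (removable xs j ∧_)
            (removable-cong (remAt j xs) xs i (remAt-!-other xs (i≢j ∘ sym)) (remAt-!-other xs (i≢j′ ∘ sym))) ⟨
  removable xs j ∧ removable (remAt j xs) i       ∎
  where open ≡-Reasoning

!-beyond : ∀ xs {m} → length xs ≤ m → xs ! m ≡ 0
!-beyond [] _ = refl
!-beyond (x ∷ xs) {suc m} (s≤s le) = !-beyond xs le

removable-beyond : ∀ xs {j} → length xs ≤ j → removable xs j ≡ false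
removable-beyond xs {j} le rewrite !-beyond xs le = refl

addable-beyond : ∀ xs {i} → suc (length xs) ≤ i → addable xs i ≡ false
addable-beyond xs {suc i} (s≤s le) = removable-beyond xs le

length-addAt : ∀ i xs → i ≤ length xs → length (addAt i xs) ≤ suc (length xs)
length-addAt zero [] _ = ≤-refl
length-addAt zero (x ∷ xs) _ = n≤1+n _
length-addAt (suc i) (x ∷ xs) (s≤s le) = s≤s (length-addAt i xs le)

length-∷₊ : ∀ x xs → length (x ∷₊ xs) ≤ suc (length xs)
length-∷₊ zero [] = z≤n
length-∷₊ zero (y ∷ ys) = ≤-refl
length-∷₊ (suc x) xs = ≤-refl

length-remAt : ∀ j xs → length (remAt j xs) ≤ length xs
length-remAt j [] = z≤n
length-remAt zero (x ∷ xs) = length-∷₊ (pred x) xs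
length-remAt (suc j) (x ∷ xs) = s≤s (length-remAt j xs)

addAt⇒addOne : ∀ i xs → i ≤ length xs → AddOne xs (addAt i xs)
addAt⇒addOne zero [] _ = new
addAt⇒addOne zero (x ∷ xs) _ = here
addAt⇒addOne (suc i) (x ∷ xs) (s≤s i≤n) = there (addAt⇒addOne i xs i≤n)

addOne⇒addAt : ∀ {xs ys} → AddOne xs ys → ∃[ i ] ys ≡ addAt i xs
addOne⇒addAt new = 0 , refl
addOne⇒addAt here = 0 , refl
addOne⇒addAt (there p) with addOne⇒addAt p
... | i , refl = suc i , refl

addOne-size : ∀ {xs ys} → AddOne xs ys → size ys ≡ suc (size xs)
addOne-size new = refl
addOne-size here = refl
addOne-size (there {a} {xs} p) = trans (cong (a +_) (addOne-size p)) (+-suc a (size xs))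

⋖-partitionˡ : ∀ {μ ν} → μ ⋖ ν → IsPartition μ
⋖-partitionˡ (P , _ , _) = P

⋖-partitionʳ : ∀ {μ ν} → μ ⋖ ν → IsPartition ν
⋖-partitionʳ (_ , Q , _) = Q

⋖-size : ∀ {μ ν} → μ ⋖ ν → size ν ≡ suc (size μ)
⋖-size (_ , _ , p) = addOne-size p

⋖-addAt : ∀ i {ρ} → IsPartition ρ → T (addable ρ i) → ρ ⋖ addAt i ρ
⋖-addAt i {ρ} P a = P , addAt-partition i P a , addAt⇒addOne i ρ (addable⇒≤length ρ i a)

remAt-⋖ : ∀ j {ρ} → IsPartition ρ → T (removable ρ j) → remAt j ρ ⋖ ρ
remAt-⋖ j {ρ} P r =
  subst (remAt j ρ ⋖_) (addAt-remAt j ρ r)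
    (⋖-addAt j (remAt-partition j P r) (addable-remAt j ρ (partition⇒decreasing P) r))

⋖⇒addAt : ∀ {ρ ν} → ρ ⋖ ν → ∃[ i ] T (addable ρ i) × ν ≡ addAt i ρ
⋖⇒addAt {ρ} (_ , Q , p) with addOne⇒addAt p
... | i , refl = i , addAt-decreasing⁻ i ρ (partition⇒decreasing Q) , refl

⋖⇒remAt : ∀ {μ ρ} → μ ⋖ ρ → ∃[ j ] T (removable ρ j) × μ ≡ remAt j ρ
⋖⇒remAt {μ} c@(P@(_ , pos) , _ , _) with ⋖⇒addAt c
... | j , a , refl =
  j , removable-addAt j μ (partition⇒decreasing P) , sym (remAt-addAt j μ pos (addable⇒≤length μ j a))

addAt-injective : ∀ xs {i i′} → addAt i xs ≡ addAt i′ xs → i ≡ i′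
addAt-injective xs {i} {i′} eq with i ≟ i′
... | yes i≡i′ = i≡i′
... | no i≢i′ = ⊥-elim (1+n≢n (begin
  suc (xs ! i)    ≡⟨ addAt-!-same i xs ⟨
  addAt i xs ! i  ≡⟨ cong (_! i) eq ⟩
  addAt i′ xs ! i ≡⟨ addAt-!-other xs (i≢i′ ∘ sym) ⟩
  xs ! i          ∎))
  where open ≡-Reasoning

remAt-injective : ∀ xs {j j′} → T (removable xs j) → remAt j xs ≡ remAt j′ xs → j ≡ j′
remAt-injective xs {j} {j′} r eq with j ≟ j′
... | yes j≡j′ = j≡j′
... | no j≢j′ = ⊥-elim (<⇒≢ (pred[n]<n (removable⇒pos xs j r)) (begin
  pred (xs ! j)   ≡⟨ remAt-!-same j xs ⟨
  remAt j xs ! j  ≡⟨ cong (_! j) eq ⟩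
  remAt j′ xs ! j ≡⟨ remAt-!-other xs (j≢j′ ∘ sym) ⟩
  xs ! j          ∎))
  where open ≡-Reasoning

addableRows removableRows : List ℕ → List ℕ
addableRows ρ = filterᵇ (addable ρ) (downFrom (suc (length ρ)))
removableRows ρ = filterᵇ (removable ρ) (downFrom (length ρ))

∈-addableRows⁻ : ∀ {ρ i} → i ∈ addableRows ρ → T (addable ρ i)
∈-addableRows⁻ {ρ} = proj₂ ∘ ∈-filter⁻ (T? ∘ addable ρ) {xs = downFrom (suc (length ρ))}

∈-addableRows⁺ : ∀ {ρ i} → T (addable ρ i) → i ∈ addableRows ρ
∈-addableRows⁺ {ρ} {i} a = ∈-filter⁺ (T? ∘ addable ρ) (∈-downFrom⁺ (s≤s (addable⇒≤length ρ i a))) a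

∈-removableRows⁻ : ∀ {ρ j} → j ∈ removableRows ρ → T (removable ρ j)
∈-removableRows⁻ {ρ} = proj₂ ∘ ∈-filter⁻ (T? ∘ removable ρ) {xs = downFrom (length ρ)}

∈-removableRows⁺ : ∀ {ρ j} → T (removable ρ j) → j ∈ removableRows ρ
∈-removableRows⁺ {ρ} {j} r = ∈-filter⁺ (T? ∘ removable ρ) (∈-downFrom⁺ (!-pos⇒<length ρ j (removable⇒pos ρ j r))) r

up down neighbours : List ℕ → List (List ℕ)
up ρ = map (λ i → addAt i ρ) (addableRows ρ)
down ρ = map (λ j → remAt j ρ) (removableRows ρ)
neighbours ρ = up ρ ++ down ρ

∈-up⇒⋖ : ∀ {ρ ν} → IsPartition ρ → ν ∈ up ρ → ρ ⋖ ν
∈-up⇒⋖ {ρ} P ν∈ with ∈-map⁻ _ ν∈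
... | i , i∈ , refl = ⋖-addAt i P (∈-addableRows⁻ {ρ} i∈)

⋖⇒∈-up : ∀ {ρ ν} → ρ ⋖ ν → ν ∈ up ρ
⋖⇒∈-up {ρ} c with ⋖⇒addAt c
... | i , a , refl = ∈-map⁺ (λ i → addAt i ρ) (∈-addableRows⁺ {ρ} a)

∈-down⇒⋖ : ∀ {ρ μ} → IsPartition ρ → μ ∈ down ρ → μ ⋖ ρ
∈-down⇒⋖ {ρ} P μ∈ with ∈-map⁻ _ μ∈
... | j , j∈ , refl = remAt-⋖ j P (∈-removableRows⁻ {ρ} j∈)

⋖⇒∈-down : ∀ {μ ρ} → μ ⋖ ρ → μ ∈ down ρ
⋖⇒∈-down {ρ = ρ} c with ⋖⇒remAt c
... | j , r , refl = ∈-map⁺ (λ j → remAt j ρ) (∈-removableRows⁺ {ρ} r)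

∈-neighbours⇒Adjacent : ∀ {ρ μ} → IsPartition ρ → μ ∈ neighbours ρ → Adjacent μ ρ
∈-neighbours⇒Adjacent {ρ} P μ∈ with ∈-++⁻ (up ρ) μ∈
... | inj₁ μ∈up = inj₂ (∈-up⇒⋖ P μ∈up)
... | inj₂ μ∈down = inj₁ (∈-down⇒⋖ P μ∈down)

Adjacent⇒∈-neighbours : ∀ {ρ μ} → Adjacent μ ρ → μ ∈ neighbours ρ
Adjacent⇒∈-neighbours (inj₁ μ⋖ρ) = ∈-++⁺ʳ _ (⋖⇒∈-down μ⋖ρ)
Adjacent⇒∈-neighbours (inj₂ ρ⋖μ) = ∈-++⁺ˡ (⋖⇒∈-up ρ⋖μ)

neighbours-unique : ∀ {ρ} → IsPartition ρ → Unique (neighbours ρ)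
neighbours-unique {ρ} P = Unique.++⁺ up-unique down-unique up-down-disjoint
  where
  up-unique : Unique (up ρ)
  up-unique = Unique.map⁺ (addAt-injective ρ)
    (Unique.filter⁺ (T? ∘ addable ρ) (Unique.downFrom⁺ (suc (length ρ))))
  down-unique : Unique (down ρ)
  down-unique = unique-map-local (Unique.filter⁺ (T? ∘ removable ρ) (Unique.downFrom⁺ (length ρ)))
    λ j∈ _ → remAt-injective ρ (∈-removableRows⁻ {ρ} j∈)
  up-down-disjoint : Disjoint (up ρ) (down ρ)
  up-down-disjoint (ν∈up , ν∈down) =
    <⇒≢ (m<n⇒m<1+n (n<1+n _)) (trans (⋖-size (∈-down⇒⋖ P ν∈down)) (cong suc (⋖-size (∈-up⇒⋖ P ν∈up))))

Adjacent⇒partition : ∀ {μ ρ} → Adjacent μ ρ → IsPartition μ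
Adjacent⇒partition (inj₁ μ⋖ρ) = ⋖-partitionˡ μ⋖ρ
Adjacent⇒partition (inj₂ ρ⋖μ) = ⋖-partitionʳ ρ⋖μ

IsOT-∷ʳ⁺ : ∀ {μ ρ l T} → IsOT μ l T → Adjacent μ ρ → IsOT ρ (suc l) (T ∷ʳ ρ)
IsOT-∷ʳ⁺ {ρ = ρ} {T = T} (len , hd , lst , lnk) adj =
  trans (length-∷ʳ T ρ) (cong suc len) ,
  trans (head-∷ʳ ρ len) hd ,
  last-∷ʳ T ρ ,
  Linked-∷ʳ⁺ lnk (λ lst′ → subst (λ ν → Adjacent ν ρ) (just-injective (trans (sym lst) lst′)) adj)

IsOT-∷ʳ⁻ : ∀ {ρ l T x} → IsOT ρ (suc l) (T ∷ʳ x) → x ≡ ρ × ∃[ μ ] Adjacent μ ρ × IsOT μ l T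
IsOT-∷ʳ⁻ {T = T} {x} (len , hd , lst , lnk)
  with last-∃ T (length-∷ʳ⁻ T len) | Linked-∷ʳ⁻ T lnk | just-injective (trans (sym (last-∷ʳ T x)) lst)
... | μ , lastT | lnk′ , adj | refl =
  refl , μ , adj lastT , length-∷ʳ⁻ T len , trans (sym (head-∷ʳ x (length-∷ʳ⁻ T len))) hd , lastT , lnk′

tableaux : List ℕ → ℕ → List (List (List ℕ))
tableaux ρ (suc l) = map (_∷ʳ ρ) (concatMap (λ μ → tableaux μ l) (neighbours ρ))
tableaux [] zero = ([] ∷ []) ∷ []
tableaux (_ ∷ _) zero = []

∈-tableaux-suc⁻ : ∀ {ρ} l {T} → T ∈ tableaux ρ (suc l) →
  ∃[ μ ] ∃[ T′ ] μ ∈ neighbours ρ × T′ ∈ tableaux μ l × T ≡ T′ ∷ʳ ρ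
∈-tableaux-suc⁻ {ρ} l T∈ with ∈-map⁻ (_∷ʳ ρ) T∈
... | T′ , T′∈ , refl with find (∈-concatMap⁻ (λ μ → tableaux μ l) T′∈)
... | μ , μ∈ , T′∈μ = μ , T′ , μ∈ , T′∈μ , refl

∈-tableaux-suc⁺ : ∀ {ρ μ} l {T} → μ ∈ neighbours ρ → T ∈ tableaux μ l → T ∷ʳ ρ ∈ tableaux ρ (suc l)
∈-tableaux-suc⁺ {ρ} l μ∈ T∈ = ∈-map⁺ (_∷ʳ ρ) (∈-concatMap⁺ (λ μ → tableaux μ l) (lose μ∈ T∈))

tableaux-last : ∀ ρ l {T} → T ∈ tableaux ρ l → last T ≡ just ρ
tableaux-last [] zero (here refl) = refl
tableaux-last ρ (suc l) T∈ with ∈-tableaux-suc⁻ l T∈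
... | _ , T′ , _ , _ , refl = last-∷ʳ T′ ρ

tableaux-sound : ∀ ρ l {T} → IsPartition ρ → T ∈ tableaux ρ l → IsOT ρ l T
tableaux-sound [] zero _ (here refl) = refl , refl , refl , [-]
tableaux-sound ρ (suc l) P T∈ with ∈-tableaux-suc⁻ l T∈
... | μ , T′ , μ∈ , T′∈ , refl =
  let adj = ∈-neighbours⇒Adjacent P μ∈ in IsOT-∷ʳ⁺ (tableaux-sound μ l (Adjacent⇒partition adj) T′∈) adj

tableaux-complete : ∀ ρ l {T} → IsOT ρ l T → T ∈ tableaux ρ l
tableaux-complete ρ zero {x ∷ []} (_ , refl , refl , _) = here refl
tableaux-complete ρ (suc l) {T} ot with initLast T
... | T′ ∷ʳ′ x with IsOT-∷ʳ⁻ ot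
... | refl , μ , adj , ot′ = ∈-tableaux-suc⁺ l (Adjacent⇒∈-neighbours adj) (tableaux-complete μ l ot′)

tableaux-unique : ∀ ρ l → IsPartition ρ → Unique (tableaux ρ l)
tableaux-unique ρ (suc l) P =
  Unique.map⁺ (∷ʳ-injectiveˡ _ _)
    (unique-concatMap (neighbours-unique P)
      (λ μ∈ → tableaux-unique _ l (Adjacent⇒partition (∈-neighbours⇒Adjacent P μ∈)))
      (λ {μ} {μ′} μ≢μ′ (T∈ , T∈′) →
        μ≢μ′ (just-injective (trans (sym (tableaux-last μ l T∈)) (tableaux-last μ′ l T∈′)))))
tableaux-unique [] zero _ = [] ∷ []
tableaux-unique (_ ∷ _) zero _ = []

U D : (List ℕ → ℕ) → List ℕ → ℕ
U h ρ = sum (map h (up ρ))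
D h ρ = sum (map h (down ρ))

U-∑< : ∀ ρ h {N} → suc (length ρ) ≤ N → U h ρ ≡ ∑< N (λ i → if addable ρ i then h (addAt i ρ) else 0)
U-∑< ρ h {N} le = begin
  sum (map h (map (λ i → addAt i ρ) (addableRows ρ))) ≡⟨ cong sum (map-∘ (addableRows ρ)) ⟨
  sum (map (λ i → h (addAt i ρ)) (addableRows ρ))     ≡⟨ sum-map-filterᵇ (addable ρ) _ (downFrom (suc (length ρ))) ⟩
  ∑< (suc (length ρ)) f                               ≡⟨ ∑<-pad N f le (λ {i} i≥ → cong (λ b → if b then h (addAt i ρ) else 0) (addable-beyond ρ i≥)) ⟨
  ∑< N f                                              ∎
  where
  open ≡-Reasoning
  f = λ i → if addable ρ i then h (addAt i ρ) else 0

D-∑< : ∀ ρ h {N} → length ρ ≤ N → D h ρ ≡ ∑< N (λ j → if removable ρ j then h (remAt j ρ) else 0)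
D-∑< ρ h {N} le = begin
  sum (map h (map (λ j → remAt j ρ) (removableRows ρ))) ≡⟨ cong sum (map-∘ (removableRows ρ)) ⟨
  sum (map (λ j → h (remAt j ρ)) (removableRows ρ))     ≡⟨ sum-map-filterᵇ (removable ρ) _ (downFrom (length ρ)) ⟩
  ∑< (length ρ) f                                       ≡⟨ ∑<-pad N f le (λ {j} j≥ → cong (λ b → if b then h (remAt j ρ) else 0) (removable-beyond ρ j≥)) ⟨
  ∑< N f                                                ∎
  where
  open ≡-Reasoning
  f = λ j → if removable ρ j then h (remAt j ρ) else 0

∑<-addable : ∀ ρ x → ∑< (suc (length ρ)) (λ i → if addable ρ i then x else 0)
                   ≡ x + ∑< (suc (length ρ)) (λ j → if removable ρ j then x else 0)
∑<-addable ρ x = trans (∑<-suc (length ρ) _)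
  (cong (x +_) (sym (∑<-pad (suc (length ρ)) _ (n≤1+n _) (λ j≥ → cong (λ b → if b then x else 0) (removable-beyond ρ j≥)))))

-- Both sides are double sums over a row i gaining a box and a row j losing one. Off the diagonal the
-- two orders of the moves are possible together and give the same shape; on the diagonal each order
-- just returns to ρ, and there is one more addable row than removable row.
U∘D : ∀ ρ h → IsPartition ρ → U (D h) ρ ≡ h ρ + D (U h) ρ
U∘D ρ h P = +-cancelʳ-≡ _ (U (D h) ρ) (h ρ + D (U h) ρ) (begin
  U (D h) ρ + ∑< N (λ i → G i i)               ≡⟨ cong (_+ ∑< N (λ i → G i i)) U∘D≡∑∑ ⟩
  ∑< N (λ i → ∑< N (F i)) + ∑< N (λ i → G i i) ≡⟨ ∑<-∑<-exchange N F G F≡G ⟩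
  ∑< N (λ i → ∑< N (G i)) + ∑< N (λ i → F i i) ≡⟨ cong₂ _+_ (sym D∘U≡∑∑) (trans (∑<-cong N (λ {i} _ → F-diagonal i)) (∑<-addable ρ (h ρ))) ⟩
  D (U h) ρ + (h ρ + ∑< N (λ j → if removable ρ j then h ρ else 0)) ≡⟨ cong (λ s → D (U h) ρ + (h ρ + s)) (∑<-cong N (λ {i} _ → sym (G-diagonal i))) ⟩
  D (U h) ρ + (h ρ + ∑< N (λ i → G i i))       ≡⟨ rotate (D (U h) ρ) (h ρ) _ ⟩
  h ρ + D (U h) ρ + ∑< N (λ i → G i i)         ∎)
  where
  open ≡-Reasoning
  rotate : ∀ a b c → a + (b + c) ≡ b + a + c
  rotate = solve-∀
  N = suc (length ρ)
  dec = partition⇒decreasing P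
  F G : ℕ → ℕ → ℕ
  F i j = if addable ρ i then (if removable (addAt i ρ) j then h (remAt j (addAt i ρ)) else 0) else 0
  G i j = if removable ρ j then (if addable (remAt j ρ) i then h (addAt i (remAt j ρ)) else 0) else 0

  U∘D≡∑∑ : U (D h) ρ ≡ ∑< N (λ i → ∑< N (F i))
  U∘D≡∑∑ = trans (U-∑< ρ (D h) ≤-refl) (∑<-cong N λ {i} _ →
    trans (if-congᵀ (addable ρ i) (λ a → D-∑< (addAt i ρ) h (length-addAt i ρ (addable⇒≤length ρ i a))))
          (if-sum-map (addable ρ i) _ (downFrom N)))

  D∘U≡∑∑ : D (U h) ρ ≡ ∑< N (λ i → ∑< N (G i))
  D∘U≡∑∑ = begin
    D (U h) ρ ≡⟨ D-∑< ρ (U h) (n≤1+n _) ⟩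
    ∑< N (λ j → if removable ρ j then U h (remAt j ρ) else 0)
      ≡⟨ ∑<-cong N (λ {j} _ → trans (if-congᵀ (removable ρ j) (λ _ → U-∑< (remAt j ρ) h (s≤s (length-remAt j ρ))))
                                    (if-sum-map (removable ρ j) _ (downFrom N))) ⟩
    ∑< N (λ j → ∑< N (λ i → G i j)) ≡⟨ sum-map-comm (λ j i → G i j) (downFrom N) (downFrom N) ⟩
    ∑< N (λ i → ∑< N (G i))         ∎

  F-diagonal : ∀ i → F i i ≡ (if addable ρ i then h ρ else 0)
  F-diagonal i = if-congᵀ (addable ρ i) λ a →
    trans (if-T (removable-addAt i ρ dec)) (cong h (remAt-addAt i ρ (proj₂ P) (addable⇒≤length ρ i a)))

  G-diagonal : ∀ i → G i i ≡ (if removable ρ i then h ρ else 0)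
  G-diagonal i = if-congᵀ (removable ρ i) λ r →
    trans (if-T (addable-remAt i ρ dec r)) (cong h (addAt-remAt i ρ r))

  F≡G : ∀ {i j} → i ≢ j → F i j ≡ G i j
  F≡G {i} {j} i≢j = begin
    F i j ≡⟨ if-∧ (addable ρ i) _ _ ⟩
    (if addable ρ i ∧ removable (addAt i ρ) j then h (remAt j (addAt i ρ)) else 0)
      ≡⟨ cong₂ (λ b ν → if b then h ν else 0) (addable-removable-comm ρ i≢j) (remAt-addAt-comm ρ i≢j) ⟩
    (if removable ρ j ∧ addable (remAt j ρ) i then h (addAt i (remAt j ρ)) else 0) ≡⟨ if-∧ (removable ρ j) _ _ ⟨
    G i j ∎

#OT ΣwtOT : ℕ → List ℕ → ℕ
#OT l ρ = length (tableaux ρ l)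
ΣwtOT l ρ = sum (map wt (tableaux ρ l))

#OT-zero : ∀ ρ → 0 < size ρ → #OT 0 ρ ≡ 0
#OT-zero (_ ∷ _) _ = refl

size*#OT-zero : ∀ ρ → size ρ * #OT 0 ρ ≡ 0
size*#OT-zero [] = refl
size*#OT-zero (x ∷ xs) = *-zeroʳ (size (x ∷ xs))

ΣwtOT-zero : ∀ ρ → ΣwtOT 0 ρ ≡ 0
ΣwtOT-zero [] = refl
ΣwtOT-zero (_ ∷ _) = refl

#OT-suc : ∀ l ρ → #OT (suc l) ρ ≡ U (#OT l) ρ + D (#OT l) ρ
#OT-suc l ρ = begin
  length (map (_∷ʳ ρ) Ts)            ≡⟨ length-map (_∷ʳ ρ) Ts ⟩
  length Ts                           ≡⟨ length-concatMap (λ μ → tableaux μ l) (neighbours ρ) ⟩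
  sum (map (#OT l) (up ρ ++ down ρ)) ≡⟨ sum-map-++ (#OT l) (up ρ) (down ρ) ⟩
  U (#OT l) ρ + D (#OT l) ρ          ∎
  where
  open ≡-Reasoning
  Ts = concatMap (λ μ → tableaux μ l) (neighbours ρ)

wt-∷ʳ : ∀ T x → wt (T ∷ʳ x) ≡ wt T + size x
wt-∷ʳ T x = trans (sum-map-++ size T (x ∷ [])) (cong (wt T +_) (+-identityʳ (size x)))

sum-map-wt-∷ʳ : ∀ x Ts → sum (map wt (map (_∷ʳ x) Ts)) ≡ sum (map wt Ts) + size x * length Ts
sum-map-wt-∷ʳ x [] = sym (*-zeroʳ (size x))
sum-map-wt-∷ʳ x (T ∷ Ts) = begin
  wt (T ∷ʳ x) + sum (map wt (map (_∷ʳ x) Ts))          ≡⟨ cong₂ _+_ (wt-∷ʳ T x) (sum-map-wt-∷ʳ x Ts) ⟩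
  wt T + size x + (sum (map wt Ts) + size x * length Ts) ≡⟨ regroup (wt T) (size x) _ (length Ts) ⟩
  wt T + sum (map wt Ts) + size x * (1 + length Ts)      ∎
  where
  open ≡-Reasoning
  regroup : ∀ a s b n → a + s + (b + s * n) ≡ a + b + s * (1 + n)
  regroup = solve-∀

ΣwtOT-suc : ∀ l ρ → ΣwtOT (suc l) ρ ≡ U (ΣwtOT l) ρ + D (ΣwtOT l) ρ + size ρ * #OT (suc l) ρ
ΣwtOT-suc l ρ = begin
  sum (map wt (map (_∷ʳ ρ) Ts))                      ≡⟨ sum-map-wt-∷ʳ ρ Ts ⟩
  sum (map wt Ts) + size ρ * length Ts               ≡⟨ cong (_+ size ρ * length Ts) (sum-map-concatMap wt _ (neighbours ρ)) ⟩
  sum (map (ΣwtOT l) (up ρ ++ down ρ)) + size ρ * length Ts ≡⟨ cong₂ _+_ (sum-map-++ (ΣwtOT l) (up ρ) (down ρ)) (cong (size ρ *_) (sym (length-map (_∷ʳ ρ) Ts))) ⟩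
  U (ΣwtOT l) ρ + D (ΣwtOT l) ρ + size ρ * #OT (suc l) ρ ∎
  where
  open ≡-Reasoning
  Ts = concatMap (λ μ → tableaux μ l) (neighbours ρ)

*-suc-pred : ∀ l (f : ℕ → ℕ) → l * f (suc (pred l)) ≡ l * f l
*-suc-pred zero f = refl
*-suc-pred (suc l) f = refl

U-size : ∀ {ρ} h → IsPartition ρ → U (λ ν → size ν * h ν) ρ ≡ suc (size ρ) * U h ρ
U-size {ρ} h P = trans (sum-map-cong (up ρ) λ {ν} ν∈ → cong (_* h ν) (⋖-size (∈-up⇒⋖ P ν∈))) (sum-map-* (suc (size ρ)) h (up ρ))

D-size : ∀ {ρ} h → IsPartition ρ → D (λ μ → suc (size μ) * h μ) ρ ≡ size ρ * D h ρ
D-size {ρ} h P = trans (sum-map-cong (down ρ) λ {μ} μ∈ → cong (_* h μ) (sym (⋖-size (∈-down⇒⋖ P μ∈)))) (sum-map-* (size ρ) h (down ρ))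

U-#OT : ∀ l ρ → IsPartition ρ → U (#OT l) ρ ≡ l * #OT (pred l) ρ
U-#OT zero ρ P = trans (sum-map-cong (up ρ) λ {ν} ν∈ → #OT-zero ν (subst (0 <_) (sym (⋖-size (∈-up⇒⋖ P ν∈))) z<s))
                       (sum-map-0 (up ρ))
U-#OT (suc l) ρ P = begin
  U (#OT (suc l)) ρ                                     ≡⟨ sum-map-cong (up ρ) (λ {ν} _ → #OT-suc l ν) ⟩
  U (λ ν → U (#OT l) ν + D (#OT l) ν) ρ                 ≡⟨ sum-map-+ _ _ (up ρ) ⟩
  U (U (#OT l)) ρ + U (D (#OT l)) ρ                     ≡⟨ cong (U (U (#OT l)) ρ +_) (U∘D ρ (#OT l) P) ⟩
  U (U (#OT l)) ρ + (#OT l ρ + D (U (#OT l)) ρ)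
    ≡⟨ cong₂ (λ a b → a + (#OT l ρ + b)) (sum-map-cong (up ρ) λ {ν} ν∈ → U-#OT l ν (⋖-partitionʳ (∈-up⇒⋖ P ν∈)))
                                           (sum-map-cong (down ρ) λ {μ} μ∈ → U-#OT l μ (⋖-partitionˡ (∈-down⇒⋖ P μ∈))) ⟩
  U (λ ν → l * #OT (pred l) ν) ρ + (#OT l ρ + D (λ μ → l * #OT (pred l) μ) ρ)
    ≡⟨ cong₂ (λ a b → a + (#OT l ρ + b)) (sum-map-* l _ (up ρ)) (sum-map-* l _ (down ρ)) ⟩
  l * U (#OT (pred l)) ρ + (#OT l ρ + l * D (#OT (pred l)) ρ) ≡⟨ regroup l (#OT l ρ) _ _ ⟩
  #OT l ρ + l * (U (#OT (pred l)) ρ + D (#OT (pred l)) ρ)    ≡⟨ cong (λ s → #OT l ρ + l * s) (#OT-suc (pred l) ρ) ⟨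
  #OT l ρ + l * #OT (suc (pred l)) ρ                         ≡⟨ cong (#OT l ρ +_) (*-suc-pred l (λ m → #OT m ρ)) ⟩
  #OT l ρ + l * #OT l ρ                                      ∎
  where
  open ≡-Reasoning
  regroup : ∀ l c a b → l * a + (c + l * b) ≡ c + l * (a + b)
  regroup = solve-∀

size*#OT : ∀ l ρ → IsPartition ρ → size ρ * #OT l ρ ≡ l * D (#OT (pred l)) ρ
size*#OT zero ρ P = size*#OT-zero ρ
size*#OT (suc l) ρ P = begin
  size ρ * #OT (suc l) ρ                                     ≡⟨ cong (size ρ *_) (#OT-suc l ρ) ⟩
  size ρ * (U (#OT l) ρ + D (#OT l) ρ)                       ≡⟨ *-distribˡ-+ (size ρ) _ _ ⟩
  size ρ * U (#OT l) ρ + size ρ * D (#OT l) ρ                ≡⟨ cong₂ _+_ size*U size*D ⟩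
  l * D (U (#OT pl)) ρ + (D (#OT l) ρ + l * D (D (#OT pl)) ρ) ≡⟨ regroup l (D (#OT l) ρ) _ _ ⟩
  D (#OT l) ρ + l * (D (U (#OT pl)) ρ + D (D (#OT pl)) ρ)    ≡⟨ cong (λ s → D (#OT l) ρ + l * s) (sum-map-+ _ _ (down ρ)) ⟨
  D (#OT l) ρ + l * D (λ μ → U (#OT pl) μ + D (#OT pl) μ) ρ ≡⟨ cong (λ s → D (#OT l) ρ + l * s) (sum-map-cong (down ρ) λ {μ} _ → #OT-suc pl μ) ⟨
  D (#OT l) ρ + l * D (#OT (suc pl)) ρ                      ≡⟨ cong (D (#OT l) ρ +_) (*-suc-pred l (λ m → D (#OT m) ρ)) ⟩
  D (#OT l) ρ + l * D (#OT l) ρ                             ∎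
  where
  open ≡-Reasoning
  pl = pred l
  regroup : ∀ l c a b → l * a + (c + l * b) ≡ c + l * (a + b)
  regroup = solve-∀

  size*D : size ρ * D (#OT l) ρ ≡ D (#OT l) ρ + l * D (D (#OT pl)) ρ
  size*D = begin
    size ρ * D (#OT l) ρ                          ≡⟨ D-size (#OT l) P ⟨
    D (λ μ → suc (size μ) * #OT l μ) ρ            ≡⟨ sum-map-+ _ _ (down ρ) ⟩
    D (#OT l) ρ + D (λ μ → size μ * #OT l μ) ρ    ≡⟨ cong (D (#OT l) ρ +_) (sum-map-cong (down ρ) λ {μ} μ∈ → size*#OT l μ (⋖-partitionˡ (∈-down⇒⋖ P μ∈))) ⟩
    D (#OT l) ρ + D (λ μ → l * D (#OT pl) μ) ρ    ≡⟨ cong (D (#OT l) ρ +_) (sum-map-* l _ (down ρ)) ⟩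
    D (#OT l) ρ + l * D (D (#OT pl)) ρ            ∎

  size*U : size ρ * U (#OT l) ρ ≡ l * D (U (#OT pl)) ρ
  size*U = +-cancelˡ-≡ (U (#OT l) ρ) _ _ (begin
    U (#OT l) ρ + size ρ * U (#OT l) ρ    ≡⟨ U-size (#OT l) P ⟨
    U (λ ν → size ν * #OT l ν) ρ          ≡⟨ sum-map-cong (up ρ) (λ {ν} ν∈ → size*#OT l ν (⋖-partitionʳ (∈-up⇒⋖ P ν∈))) ⟩
    U (λ ν → l * D (#OT pl) ν) ρ          ≡⟨ sum-map-* l _ (up ρ) ⟩
    l * U (D (#OT pl)) ρ                  ≡⟨ cong (l *_) (U∘D ρ (#OT pl) P) ⟩
    l * (#OT pl ρ + D (U (#OT pl)) ρ)     ≡⟨ *-distribˡ-+ l _ _ ⟩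
    l * #OT pl ρ + l * D (U (#OT pl)) ρ   ≡⟨ cong (_+ l * D (U (#OT pl)) ρ) (U-#OT l ρ P) ⟨
    U (#OT l) ρ + l * D (U (#OT pl)) ρ    ∎)

sum-6*ΣwtOT : ∀ l xs → (∀ {μ} → μ ∈ xs → 6 * ΣwtOT l μ ≡ suc l * (l + 2 * size μ) * #OT l μ) →
  6 * sum (map (ΣwtOT l) xs) ≡ suc l * l * sum (map (#OT l) xs) + 2 * suc l * sum (map (λ μ → size μ * #OT l μ) xs)
sum-6*ΣwtOT l xs ih = begin
  6 * sum (map (ΣwtOT l) xs)                                      ≡⟨ sum-map-* 6 (ΣwtOT l) xs ⟨
  sum (map (λ μ → 6 * ΣwtOT l μ) xs)                              ≡⟨ sum-map-cong xs (λ {μ} μ∈ → trans (ih μ∈) (split l (size μ) (#OT l μ))) ⟩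
  sum (map (λ μ → suc l * l * #OT l μ + 2 * suc l * (size μ * #OT l μ)) xs)
    ≡⟨ trans (sum-map-+ _ _ xs) (cong₂ _+_ (sum-map-* (suc l * l) (#OT l) xs) (sum-map-* (2 * suc l) _ xs)) ⟩
  suc l * l * sum (map (#OT l) xs) + 2 * suc l * sum (map (λ μ → size μ * #OT l μ) xs) ∎
  where
  open ≡-Reasoning
  split : ∀ l s c → suc l * (l + 2 * s) * c ≡ suc l * l * c + 2 * suc l * (s * c)
  split = solve-∀

-- The arithmetic of the induction step of 6*ΣwtOT, where A, B, S are U (#OT l) ρ, D (#OT l) ρ and
-- D (λ μ → size μ * #OT l μ) ρ, and k = size ρ.
weight-step : ∀ l k A B S → S + B ≡ k * B →
  suc l * l * A + 2 * suc l * (suc k * A) + (suc l * l * B + 2 * suc l * S) + 6 * (k * (A + B)) + 4 * (suc l * B)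
  ≡ suc (suc l) * (suc l + 2 * k) * (A + B) + 4 * (k * (A + B))
weight-step l k A B S S+B≡k*B = begin
  suc l * l * A + 2 * suc l * (suc k * A) + (suc l * l * B + 2 * suc l * S) + 6 * (k * (A + B)) + 4 * (suc l * B)
    ≡⟨ collect l k A B S ⟩
  rest + 2 * suc l * (S + B) ≡⟨ cong (λ x → rest + 2 * suc l * x) S+B≡k*B ⟩
  rest + 2 * suc l * (k * B) ≡⟨ close l k A B ⟩
  suc (suc l) * (suc l + 2 * k) * (A + B) + 4 * (k * (A + B)) ∎
  where
  open ≡-Reasoning
  rest = suc l * l * (A + B) + 2 * suc l * (suc k * A) + 6 * (k * (A + B)) + 2 * suc l * B
  collect : ∀ l k A B S →
    suc l * l * A + 2 * suc l * (suc k * A) + (suc l * l * B + 2 * suc l * S) + 6 * (k * (A + B)) + 4 * (suc l * B)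
    ≡ suc l * l * (A + B) + 2 * suc l * (suc k * A) + 6 * (k * (A + B)) + 2 * suc l * B + 2 * suc l * (S + B)
  collect = solve-∀
  close : ∀ l k A B →
    suc l * l * (A + B) + 2 * suc l * (suc k * A) + 6 * (k * (A + B)) + 2 * suc l * B + 2 * suc l * (k * B)
    ≡ suc (suc l) * (suc l + 2 * k) * (A + B) + 4 * (k * (A + B))
  close = solve-∀

6*ΣwtOT : ∀ l ρ → IsPartition ρ → 6 * ΣwtOT l ρ ≡ suc l * (l + 2 * size ρ) * #OT l ρ
6*ΣwtOT zero ρ P = begin
  6 * ΣwtOT 0 ρ                    ≡⟨ cong (6 *_) (ΣwtOT-zero ρ) ⟩
  0                                ≡⟨ cong (2 *_) (size*#OT-zero ρ) ⟨
  2 * (size ρ * #OT 0 ρ)           ≡⟨ reassoc (size ρ) (#OT 0 ρ) ⟩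
  1 * (0 + 2 * size ρ) * #OT 0 ρ   ∎
  where
  open ≡-Reasoning
  reassoc : ∀ k c → 2 * (k * c) ≡ 1 * (0 + 2 * k) * c
  reassoc = solve-∀
6*ΣwtOT (suc l) ρ P = +-cancelʳ-≡ (4 * (k * W)) _ _ (begin
  6 * ΣwtOT (suc l) ρ + 4 * (k * W)
    ≡⟨ cong₂ _+_ (cong (6 *_) (ΣwtOT-suc l ρ)) (cong (4 *_) (size*#OT (suc l) ρ P)) ⟩
  6 * (U (ΣwtOT l) ρ + D (ΣwtOT l) ρ + k * W) + 4 * (suc l * B)
    ≡⟨ cong (λ w → 6 * (U (ΣwtOT l) ρ + D (ΣwtOT l) ρ + k * w) + 4 * (suc l * B)) W≡A+B ⟩
  6 * (U (ΣwtOT l) ρ + D (ΣwtOT l) ρ + k * (A + B)) + 4 * (suc l * B)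
    ≡⟨ distrib (U (ΣwtOT l) ρ) (D (ΣwtOT l) ρ) (k * (A + B)) (4 * (suc l * B)) ⟩
  6 * U (ΣwtOT l) ρ + 6 * D (ΣwtOT l) ρ + 6 * (k * (A + B)) + 4 * (suc l * B)
    ≡⟨ cong₂ (λ a b → a + b + 6 * (k * (A + B)) + 4 * (suc l * B)) above below ⟩
  suc l * l * A + 2 * suc l * (suc k * A) + (suc l * l * B + 2 * suc l * S) + 6 * (k * (A + B)) + 4 * (suc l * B)
    ≡⟨ weight-step l k A B S S+B≡k*B ⟩
  suc (suc l) * (suc l + 2 * k) * (A + B) + 4 * (k * (A + B))
    ≡⟨ cong (λ w → suc (suc l) * (suc l + 2 * k) * w + 4 * (k * w)) W≡A+B ⟨
  suc (suc l) * (suc l + 2 * k) * W + 4 * (k * W) ∎)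
  where
  open ≡-Reasoning
  k = size ρ
  W = #OT (suc l) ρ
  A = U (#OT l) ρ
  B = D (#OT l) ρ
  S = D (λ μ → size μ * #OT l μ) ρ
  W≡A+B : W ≡ A + B
  W≡A+B = #OT-suc l ρ
  distrib : ∀ a b c d → 6 * (a + b + c) + d ≡ 6 * a + 6 * b + 6 * c + d
  distrib = solve-∀
  above : 6 * U (ΣwtOT l) ρ ≡ suc l * l * A + 2 * suc l * (suc k * A)
  above = trans (sum-6*ΣwtOT l (up ρ) λ {ν} ν∈ → 6*ΣwtOT l ν (⋖-partitionʳ (∈-up⇒⋖ P ν∈)))
                (cong (λ s → suc l * l * A + 2 * suc l * s) (U-size (#OT l) P))
  below : 6 * D (ΣwtOT l) ρ ≡ suc l * l * B + 2 * suc l * S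
  below = sum-6*ΣwtOT l (down ρ) λ {μ} μ∈ → 6*ΣwtOT l μ (⋖-partitionˡ (∈-down⇒⋖ P μ∈))
  S+B≡k*B : S + B ≡ k * B
  S+B≡k*B = trans (+-comm S B) (trans (sym (sum-map-+ (#OT l) _ (down ρ))) (D-size (#OT l) P))

theorem2 : (shape : List ℕ) → IsPartition shape → (n : ℕ)
    → (L : List (List (List ℕ))) → Unique L
    → (∀ T → (T ∈ L) ⇔ IsOT shape (size shape + 2 * n) T)
    → 6 * sum (map wt L)
      ≡ length L * (4 * (n * n) + 3 * (size shape * size shape) + 8 * (size shape * n) + 2 * n + 3 * size shape)
theorem2 shape P n L L-unique L-enumerates = begin
  6 * sum (map wt L)                        ≡⟨ cong (6 *_) (sum-↭ (↭-map⁺ wt L↭tableaux)) ⟩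
  6 * ΣwtOT l shape                         ≡⟨ 6*ΣwtOT l shape P ⟩
  suc l * (l + 2 * k) * #OT l shape         ≡⟨ expand k n (#OT l shape) ⟩
  #OT l shape * sixMean                     ≡⟨ cong (_* sixMean) (↭-length L↭tableaux) ⟨
  length L * sixMean                        ∎
  where
  open ≡-Reasoning
  k = size shape
  l = k + 2 * n
  sixMean = 4 * (n * n) + 3 * (k * k) + 8 * (k * n) + 2 * n + 3 * k
  L↭tableaux : L ↭ tableaux shape l
  L↭tableaux = ∼bag⇒↭ (unique∧set⇒bag L-unique (tableaux-unique shape l P) λ {T} →
    mk⇔ (tableaux-complete shape l ∘ Equivalence.to (L-enumerates T))
        (Equivalence.from (L-enumerates T) ∘ tableaux-sound shape l P))
  expand : ∀ k n c → suc (k + 2 * n) * (k + 2 * n + 2 * k) * c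
                   ≡ c * (4 * (n * n) + 3 * (k * k) + 8 * (k * n) + 2 * n + 3 * k)
  expand = solve-∀
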